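{- Let $\alpha$ be a nonzero integer and let $(h_n)$ be the sequence with $h_0=0$, $h_1=1$, $h_2=-\alpha$, $h_3=-\alpha^3$, $h_4=0$, and for $m\ge2$: $h_{2m+1}=h_{m+2}h_m^3-h_{m-1}h_{m+1}^3$, for $m\ge 3$: $h_{2m}=h_m\big(h_{m+2}h_{m-1}^2-h_{m-2}h_{m+1}^2\big)/h_2$. (i) If $n\equiv 1,7\pmod 8$, then $h_n$ is a square. (ii) If $n\equiv 1,3,5,7\pmod 8$, then $h_n$ is a cube.
   Context: The sequence defined is the elliptic divisibility sequence attached to the point $(0,0)$ of order $4$ on the curve $y^2+xy-\alpha y=x^3-\alpha x^2$ (Tate normal form); its fourth term is zero. Convention: an integer $m$ is called a square if $m=\pm\beta^2$ for some nonzero integer $\beta$, and a cube if $m=\beta^3$ for some nonzero integer $\beta$. -}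

module Defs where

open import Data.Nat as ℕ using (ℕ; _≤_; _∸_)
open import Data.Integer as ℤ using (ℤ; _*_; _-_; -_; 0ℤ; 1ℤ)
open import Data.Product using (Σ; _×_)
open import Data.Sum using (_⊎_)
open import Relation.Binary.PropositionalEquality using (_≡_; _≢_)

IsSquare : ℤ → Set
IsSquare m = Σ ℤ λ β → β ≢ 0ℤ × (m ≡ β * β ⊎ m ≡ - (β * β))

IsCube : ℤ → Set
IsCube m = Σ ℤ λ β → β ≢ 0ℤ × m ≡ β * β * β

-- The division by h₂ in the
-- even-index recurrence is written multiplicatively: h₂ · h_{2m} = h_m (…).
-- Since h₂ = -α ≠ 0, this determines h_{2m} uniquely (ℤ is an integral domain).
record IsSeq (α : ℤ) (h : ℕ → ℤ) : Set where
  field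
    h0 : h 0 ≡ 0ℤ
    h1 : h 1 ≡ 1ℤ
    h2 : h 2 ≡ - α
    h3 : h 3 ≡ - (α * α * α)
    h4 : h 4 ≡ 0ℤ
    odd : ∀ m → 2 ≤ m →
      h (ℕ._+_ (ℕ._*_ 2 m) 1) ≡ h (ℕ._+_ m 2) * (h m * h m * h m)
                                 - h (m ∸ 1) * (h (ℕ._+_ m 1) * h (ℕ._+_ m 1) * h (ℕ._+_ m 1))
    even : ∀ m → 3 ≤ m →
      h 2 * h (ℕ._*_ 2 m) ≡ h m * (h (ℕ._+_ m 2) * (h (m ∸ 1) * h (m ∸ 1))
                                   - h (m ∸ 2) * (h (ℕ._+_ m 1) * h (ℕ._+_ m 1)))

module Submission where

-- The sequence h of `IsSeq α h` is the elliptic divisibility sequence of a point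
-- of order 4, and its terms have the closed form
--     h (4q) = 0,     h (4q + r) = ± α ^ eᵣ(q)   (r = 1, 2, 3),
-- with e₁(q) = 6q² + 3q, e₂(q) = 6q² + 6q + 1, e₃(q) = 6q² + 9q + 3
-- (that is, h n = ± α ^ ⌊3n²/8⌋ whenever 4 ∤ n).
-- Both facts are proved by "halving induction" on the block number q: the
-- recurrences express block 2k + 2 through blocks k, k + 1 and block 2k + 3
-- through blocks k + 1, k + 2; in every instance one of the two terms of the
-- recurrence contains a factor h (4j) and vanishes, so each new term is ± a
-- product of earlier ones and the exponents add up (polynomial identities in k).
-- The even-index recurrence carries the extra factor h 2 = - α, which is cancelled.
-- For odd n the exponent 3(n² - 1)/8 is a multiple of 3, and it is even when
-- n ≡ ±1 (mod 8); this gives the cubes and the squares.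

open import Defs
open import Data.Nat using (ℕ; _%_)
open import Data.Integer using (ℤ; 0ℤ)
open import Data.Product using (_×_)
open import Data.Sum using (_⊎_)
open import Relation.Binary.PropositionalEquality using (_≡_; _≢_)

open import Function using (_∘_)
open import Data.Nat using (zero; suc; _+_; _*_; _∸_; _/_; _≤_; _<_; s≤s; z≤n)
open import Data.Nat.Properties using (+-suc; +-comm; m≤m+n; m≤n+m)
open import Data.Nat.DivMod using (m≡m%n+[m/n]*n)
open import Data.Nat.Induction using (<-rec)
open import Data.Nat.Tactic.RingSolver using (solve; solve-∀)
open import Data.Integer using (1ℤ; -_; _-_; _^_; ≢-nonZero) renaming (_*_ to _·_)
import Data.Integer.Properties as ℤ
import Data.Integer.Tactic.RingSolver as ℤ-Ring
open import Data.List using (_∷_; [])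
open import Data.Product using (_,_; proj₁; proj₂)
open import Data.Sum using (inj₁; inj₂; map₂)
open import Relation.Binary.PropositionalEquality
  using (refl; sym; trans; cong; cong₂; subst; module ≡-Reasoning)

square cube : ℤ → ℤ
square x = x · x
cube x = x · x · x

infix 4 _≈±_
_≈±_ : ℤ → ℤ → Set
x ≈± y = x ≡ y ⊎ x ≡ - y

≈±-respˡ : ∀ {x x′ y} → x ≡ x′ → x′ ≈± y → x ≈± y
≈±-respˡ refl p = p

≈±-neg : ∀ {x y} → x ≈± y → - x ≈± y
≈±-neg (inj₁ x≡y) = inj₂ (cong -_ x≡y)
≈±-neg {y = y} (inj₂ x≡-y) = inj₁ (trans (cong -_ x≡-y) (ℤ.neg-involutive y))

≈±-negʳ : ∀ {x y} → x ≈± - y → x ≈± y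
≈±-negʳ (inj₁ x≡-y) = inj₂ x≡-y
≈±-negʳ {y = y} (inj₂ x≡--y) = inj₁ (trans x≡--y (ℤ.neg-involutive y))

neg·neg : ∀ x y → (- x) · (- y) ≡ x · y
neg·neg = ℤ-Ring.solve-∀

≈±-· : ∀ {x y u v} → x ≈± y → u ≈± v → x · u ≈± y · v
≈±-· (inj₁ p) (inj₁ q) = inj₁ (cong₂ _·_ p q)
≈±-· {y = y} {v = v} (inj₁ p) (inj₂ q) =
  inj₂ (trans (cong₂ _·_ p q) (sym (ℤ.neg-distribʳ-* y v)))
≈±-· {y = y} {v = v} (inj₂ p) (inj₁ q) =
  inj₂ (trans (cong₂ _·_ p q) (sym (ℤ.neg-distribˡ-* y v)))
≈±-· {y = y} {v = v} (inj₂ p) (inj₂ q) = inj₁ (trans (cong₂ _·_ p q) (neg·neg y v))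

≈±-cancelˡ : ∀ {c x y} → c ≢ 0ℤ → c · x ≈± c · y → x ≈± y
≈±-cancelˡ {c} {x} {y} c≢0 (inj₁ p) = inj₁ (ℤ.*-cancelˡ-≡ c x y {{≢-nonZero c≢0}} p)
≈±-cancelˡ {c} {x} {y} c≢0 (inj₂ p) =
  inj₂ (ℤ.*-cancelˡ-≡ c x (- y) {{≢-nonZero c≢0}} (trans p (ℤ.neg-distribʳ-* c y)))

cube-neg : ∀ x → - (x · x · x) ≡ (- x) · (- x) · (- x)
cube-neg = ℤ-Ring.solve-∀

≈±-cube⇒IsCube : ∀ {x β} → β ≢ 0ℤ → x ≈± cube β → IsCube x
≈±-cube⇒IsCube {β = β} β≢0 (inj₁ p) = β , β≢0 , p
≈±-cube⇒IsCube {β = β} β≢0 (inj₂ p) =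
  - β , (λ -β≡0 → β≢0 (ℤ.neg-injective -β≡0)) , trans p (cube-neg β)

zero-product : ∀ {x y} → x ≡ 0ℤ ⊎ y ≡ 0ℤ → x · y ≡ 0ℤ
zero-product (inj₁ refl) = refl
zero-product {x} (inj₂ refl) = ℤ.*-zeroʳ x

first-vanishes : ∀ {x} y → x ≡ 0ℤ → x - y ≡ - y
first-vanishes y refl = ℤ.+-identityˡ (- y)

second-vanishes : ∀ x {y} → y ≡ 0ℤ → x - y ≡ x
second-vanishes x refl = ℤ.+-identityʳ x

both-vanish : ∀ {x y} → x ≡ 0ℤ → y ≡ 0ℤ → x - y ≡ 0ℤ
both-vanish refl refl = refl

-- `SignedPower α e x`: x = ± α ^ e.  A record, so that the exponent can be
-- inferred from the type (α ^_ itself is not injective).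
record SignedPower (α : ℤ) (e : ℕ) (x : ℤ) : Set where
  constructor signed-power
  field
    ≈±-power : x ≈± α ^ e

twice : ∀ t → 2 * t ≡ t + t
twice = solve-∀

thrice : ∀ t → 3 * t ≡ t + t + t
thrice = solve-∀

module _ {α : ℤ} where

  pow-cast : ∀ {x i j} → i ≡ j → SignedPower α i x → SignedPower α j x
  pow-cast refl p = p

  pow-respˡ : ∀ {x x′ e} → x ≡ x′ → SignedPower α e x′ → SignedPower α e x
  pow-respˡ refl p = p

  pow-neg : ∀ {x e} → SignedPower α e x → SignedPower α e (- x)
  pow-neg (signed-power p) = signed-power (≈±-neg p)

  pow-· : ∀ {x y i j} → SignedPower α i x → SignedPower α j y → SignedPower α (i + j) (x · y)
  pow-· {x} {y} {i} {j} (signed-power p) (signed-power q) =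
    signed-power (subst (x · y ≈±_) (sym (ℤ.^-distribˡ-+-* α i j)) (≈±-· p q))

  pow-square : ∀ {x i} → SignedPower α i x → SignedPower α (2 * i) (square x)
  pow-square {i = i} p = pow-cast (sym (twice i)) (pow-· p p)

  pow-cube : ∀ {x i} → SignedPower α i x → SignedPower α (3 * i) (cube x)
  pow-cube {i = i} p = pow-cast (sym (thrice i)) (pow-· (pow-· p p) p)

  ^-square : ∀ t → α ^ (2 * t) ≡ square (α ^ t)
  ^-square t = trans (cong (α ^_) (twice t)) (ℤ.^-distribˡ-+-* α t t)

  ^-cube : ∀ t → α ^ (3 * t) ≡ cube (α ^ t)
  ^-cube t = begin
      α ^ (3 * t)           ≡⟨ cong (α ^_) (thrice t) ⟩
      α ^ (t + t + t)       ≡⟨ ℤ.^-distribˡ-+-* α (t + t) t ⟩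
      α ^ (t + t) · α ^ t   ≡⟨ cong (_· α ^ t) (ℤ.^-distribˡ-+-* α t t) ⟩
      cube (α ^ t)          ∎
    where open ≡-Reasoning

  ^≢0 : α ≢ 0ℤ → ∀ t → α ^ t ≢ 0ℤ
  ^≢0 α≢0 t αᵗ≡0 = α≢0 (ℤ.i^n≡0⇒i≡0 α t αᵗ≡0)

  pow-IsSquare : α ≢ 0ℤ → ∀ {x} t → SignedPower α (2 * t) x → IsSquare x
  pow-IsSquare α≢0 {x} t (signed-power p) = α ^ t , ^≢0 α≢0 t , subst (x ≈±_) (^-square t) p

  pow-IsCube : α ≢ 0ℤ → ∀ {x} t → SignedPower α (3 * t) x → IsCube x
  pow-IsCube α≢0 {x} t (signed-power p) =
    ≈±-cube⇒IsCube (^≢0 α≢0 t) (subst (x ≈±_) (^-cube t) p)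

data Parity : ℕ → Set where
  double   : ∀ k → Parity (k + k)
  double+1 : ∀ k → Parity (suc (k + k))

parity : ∀ n → Parity n
parity zero = double 0
parity (suc n) with parity n
... | double k = double+1 k
... | double+1 k = subst Parity (cong suc (+-suc k k)) (double (suc k))

halving-induction : (P : ℕ → Set) → P 0 → P 1 →
  (∀ k → P k → P (suc k) → P (suc k + suc k)) →
  (∀ k → P (suc k) → P (suc (suc k)) → P (suc (suc k + suc k))) →
  ∀ n → P n
halving-induction P P0 P1 P-even P-odd = <-rec P step
  where
  step : ∀ n → (∀ {m} → m < n → P m) → P n
  step n below with parity n
  ... | double zero = P0
  ... | double (suc k) = P-even k (below (s≤s (m≤m+n k (suc k)))) (below (s≤s (m≤n+m (suc k) k)))
  ... | double+1 zero = P1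
  ... | double+1 (suc k) = P-odd k (below (s≤s (m≤m+n (suc k) (suc k))))
                              (below (s≤s (s≤s (m≤n+m (suc k) k))))

-- The exponents of the closed form: eᵣ(q) = ⌊3(4q + r)²/8⌋.  They are inlined so
-- that the ring solver sees the polynomials in the identities below.
e₁ e₂ e₃ : ℕ → ℕ
e₁ q = 6 * q * q + 3 * q
e₂ q = 6 * q * q + 6 * q + 1
e₃ q = 6 * q * q + 9 * q + 3
{-# INLINE e₁ #-}
{-# INLINE e₂ #-}
{-# INLINE e₃ #-}

e[8k+9] : ∀ k → e₃ k + 3 * e₁ (suc k) ≡ e₁ (suc k + suc k)
e[8k+9] = solve-∀

e[8k+10] : ∀ k → e₁ (suc k) + (e₃ k + 2 * e₂ (suc k)) ≡ suc (e₂ (suc k + suc k))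
e[8k+10] = solve-∀

e[8k+11] : ∀ k → e₃ (suc k) + 3 * e₁ (suc k) ≡ e₃ (suc k + suc k)
e[8k+11] = solve-∀

e[8k+5] : ∀ k → e₁ k + 3 * e₃ k ≡ e₁ (suc (k + k))
e[8k+5] = solve-∀

e[8k+6] : ∀ k → e₃ k + (e₁ (suc k) + 2 * e₂ k) ≡ suc (e₂ (suc (k + k)))
e[8k+6] = solve-∀

e[8k+7] : ∀ k → e₁ (suc k) + 3 * e₃ k ≡ e₃ (suc (k + k))
e[8k+7] = solve-∀

e₁-cube : ∀ q → e₁ q ≡ 3 * (2 * q * q + q)
e₁-cube = solve-∀

e₃-cube : ∀ q → e₃ q ≡ 3 * (2 * q * q + 3 * q + 1)
e₃-cube = solve-∀

e₁-square : ∀ j → e₁ (j + j) ≡ 2 * (12 * j * j + 3 * j)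
e₁-square = solve-∀

e₃-square : ∀ j → e₃ (suc (j + j)) ≡ 2 * (12 * j * j + 21 * j + 9)
e₃-square = solve-∀

-- m ∸ 1 and m ∸ 2 below reduce to sums c + 4 * k; this puts the case c = 4 in block form
-- (the other cases are instances of +-comm).
4+4k≡4[1+k] : ∀ k → 4 + 4 * k ≡ 4 * suc k
4+4k≡4[1+k] = solve-∀

module Sequence (α : ℤ) (α≢0 : α ≢ 0ℤ) (h : ℕ → ℤ) (S : IsSeq α h) where
  open IsSeq S

  h₂≢0 : h 2 ≢ 0ℤ
  h₂≢0 h₂≡0 = α≢0 (ℤ.neg-injective (trans (sym h2) h₂≡0))

  h₂-cancel-zero : ∀ {x} → h 2 · x ≡ 0ℤ → x ≡ 0ℤ
  h₂-cancel-zero {x} eq =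
    ℤ.*-cancelˡ-≡ (h 2) x 0ℤ {{≢-nonZero h₂≢0}} (trans eq (sym (ℤ.*-zeroʳ (h 2))))

  h₂-cancel : ∀ {x y e} → h 2 · x ≡ y → SignedPower α (suc e) y → SignedPower α e x
  h₂-cancel {x} {y} {e} eq (signed-power p) =
    signed-power (≈±-cancelˡ h₂≢0 (≈±-respˡ eq (≈±-negʳ (subst (y ≈±_) αᵉ⁺¹≡-h₂αᵉ p))))
    where
    αᵉ⁺¹≡-h₂αᵉ : α · α ^ e ≡ - (h 2 · α ^ e)
    αᵉ⁺¹≡-h₂αᵉ = trans (sym (ℤ.neg-involutive _))
                       (cong -_ (trans (ℤ.neg-distribˡ-* α (α ^ e)) (cong (_· α ^ e) (sym h2))))

  -- The indices of the surviving factors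
  -- are given by equations, so that each instance can be stated in the block
  -- coordinates 4q + r used below.
  odd-first-vanishes : ∀ m {n c d} → 2 ≤ m → 2 * m + 1 ≡ n → m ∸ 1 ≡ c → m + 1 ≡ d →
    h (m + 2) ≡ 0ℤ ⊎ h m ≡ 0ℤ → h n ≡ - (h c · cube (h d))
  odd-first-vanishes m 2≤m refl refl refl z =
    trans (odd m 2≤m) (first-vanishes _ (zero-product (map₂ (cong cube) z)))

  odd-second-vanishes : ∀ m {n a b} → 2 ≤ m → 2 * m + 1 ≡ n → m + 2 ≡ a → m ≡ b →
    h (m ∸ 1) ≡ 0ℤ ⊎ h (m + 1) ≡ 0ℤ → h n ≡ h a · cube (h b)
  odd-second-vanishes m 2≤m refl refl refl z =
    trans (odd m 2≤m) (second-vanishes _ (zero-product (map₂ (cong cube) z)))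

  even-first-vanishes : ∀ m {n b d f} → 3 ≤ m → 2 * m ≡ n → m ≡ b → m ∸ 2 ≡ d → m + 1 ≡ f →
    h (m + 2) ≡ 0ℤ ⊎ h (m ∸ 1) ≡ 0ℤ → h 2 · h n ≡ - (h b · (h d · square (h f)))
  even-first-vanishes m 3≤m refl refl refl refl z =
    trans (even m 3≤m)
      (trans (cong (h m ·_) (first-vanishes _ (zero-product (map₂ (cong square) z))))
             (sym (ℤ.neg-distribʳ-* (h m) _)))

  even-second-vanishes : ∀ m {n a b c} → 3 ≤ m → 2 * m ≡ n → m + 2 ≡ a → m ≡ b → m ∸ 1 ≡ c →
    h (m ∸ 2) ≡ 0ℤ ⊎ h (m + 1) ≡ 0ℤ → h 2 · h n ≡ h b · (h a · square (h c))
  even-second-vanishes m 3≤m refl refl refl refl z =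
    trans (even m 3≤m) (cong (h m ·_) (second-vanishes _ (zero-product (map₂ (cong square) z))))

  even-vanishes : ∀ m {n} → 3 ≤ m → 2 * m ≡ n →
    h m ≡ 0ℤ ⊎ (h (m + 2) ≡ 0ℤ × h (m ∸ 2) ≡ 0ℤ) → h n ≡ 0ℤ
  even-vanishes m 3≤m refl z = h₂-cancel-zero (trans (even m 3≤m) (zero-product (map₂ both z)))
    where
    both : h (m + 2) ≡ 0ℤ × h (m ∸ 2) ≡ 0ℤ → _ ≡ 0ℤ
    both (a≡0 , d≡0) = both-vanish (zero-product (inj₁ a≡0)) (zero-product (inj₁ d≡0))

  zero-at : ∀ {j} → h j ≡ 0ℤ → ∀ {i} → i ≡ j → h i ≡ 0ℤ
  zero-at z refl = z

  -- h vanishes at the multiples of 4, the order of the point (0,0).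
  h[4q]≡0 : ∀ q → h (4 * q) ≡ 0ℤ
  h[4q]≡0 = halving-induction (λ q → h (4 * q) ≡ 0ℤ) h0 h4 h-8k+8 h-8k+12
    where
    -- the recurrence at m = 4k + 4, whose factor h m vanishes
    h-8k+8 : ∀ k → h (4 * k) ≡ 0ℤ → h (4 * suc k) ≡ 0ℤ → h (4 * (suc k + suc k)) ≡ 0ℤ
    h-8k+8 k _ z = even-vanishes (4 + 4 * k) (s≤s (s≤s (s≤s z≤n))) (solve (k ∷ []))
                     (inj₁ (zero-at z (4+4k≡4[1+k] k)))
    -- the recurrence at m = 4k + 6, whose factors h (m + 2), h (m - 2) vanish
    h-8k+12 : ∀ k → h (4 * suc k) ≡ 0ℤ → h (4 * suc (suc k)) ≡ 0ℤ →
              h (4 * suc (suc k + suc k)) ≡ 0ℤ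
    h-8k+12 k z z′ = even-vanishes (6 + 4 * k) (s≤s (s≤s (s≤s z≤n))) (solve (k ∷ []))
                       (inj₂ (zero-at z′ (solve (k ∷ [])) , zero-at z (4+4k≡4[1+k] k)))

  vanishes-at : ∀ q {i} → i ≡ 4 * q → h i ≡ 0ℤ
  vanishes-at q = zero-at (h[4q]≡0 q)

  -- The six recurrence instances that determine the blocks 2k + 1 and 2k + 2 from
  -- the blocks k and k + 1; in each the term containing some h (4j) drops out.
  -- m = 4k + 4, the vanishing factor is h m
  h-8k+9 : ∀ k → h (4 * (suc k + suc k) + 1) ≡ - (h (4 * k + 3) · cube (h (4 * suc k + 1)))
  h-8k+9 k = odd-first-vanishes (4 + 4 * k) (s≤s (s≤s z≤n)) (solve (k ∷ [])) (+-comm 3 (4 * k))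
               (solve (k ∷ [])) (inj₂ (vanishes-at (suc k) (4+4k≡4[1+k] k)))

  -- m = 4k + 5, the vanishing factor is h (m - 1)
  h-8k+10 : ∀ k → h 2 · h (4 * (suc k + suc k) + 2)
                  ≡ - (h (4 * suc k + 1) · (h (4 * k + 3) · square (h (4 * suc k + 2))))
  h-8k+10 k = even-first-vanishes (5 + 4 * k) (s≤s (s≤s (s≤s z≤n))) (solve (k ∷ []))
                (solve (k ∷ [])) (+-comm 3 (4 * k)) (solve (k ∷ []))
                (inj₂ (vanishes-at (suc k) (4+4k≡4[1+k] k)))

  -- m = 4k + 5, the vanishing factor is h (m - 1)
  h-8k+11 : ∀ k → h (4 * (suc k + suc k) + 3) ≡ h (4 * suc k + 3) · cube (h (4 * suc k + 1))
  h-8k+11 k = odd-second-vanishes (5 + 4 * k) (s≤s (s≤s z≤n)) (solve (k ∷ [])) (solve (k ∷ []))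
                (solve (k ∷ [])) (inj₁ (vanishes-at (suc k) (4+4k≡4[1+k] k)))

  -- m = 4k + 2, the vanishing factor is h (m + 2)
  h-8k+5 : ∀ k → h (4 * suc (k + k) + 1) ≡ - (h (4 * k + 1) · cube (h (4 * k + 3)))
  h-8k+5 k = odd-first-vanishes (2 + 4 * k) (s≤s (s≤s z≤n)) (solve (k ∷ [])) (+-comm 1 (4 * k))
               (solve (k ∷ [])) (inj₁ (vanishes-at (suc k) (solve (k ∷ []))))

  -- m = 4k + 3, the vanishing factor is h (m + 1)
  h-8k+6 : ∀ k → h 2 · h (4 * suc (k + k) + 2)
                 ≡ h (4 * k + 3) · (h (4 * suc k + 1) · square (h (4 * k + 2)))
  h-8k+6 k = even-second-vanishes (3 + 4 * k) (s≤s (s≤s (s≤s z≤n))) (solve (k ∷ []))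
               (solve (k ∷ [])) (+-comm 3 (4 * k)) (+-comm 2 (4 * k))
               (inj₂ (vanishes-at (suc k) (solve (k ∷ []))))

  -- m = 4k + 3, the vanishing factor is h (m + 1)
  h-8k+7 : ∀ k → h (4 * suc (k + k) + 3) ≡ h (4 * suc k + 1) · cube (h (4 * k + 3))
  h-8k+7 k = odd-second-vanishes (3 + 4 * k) (s≤s (s≤s z≤n)) (solve (k ∷ [])) (solve (k ∷ []))
               (+-comm 3 (4 * k)) (inj₂ (vanishes-at (suc k) (solve (k ∷ []))))

  record Block (q : ℕ) : Set where
    field
      at1 : SignedPower α (e₁ q) (h (4 * q + 1))
      at2 : SignedPower α (e₂ q) (h (4 * q + 2))
      at3 : SignedPower α (e₃ q) (h (4 * q + 3))
  open Block

  block₀ : Block 0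
  block₀ = record
    { at1 = signed-power (inj₁ h1)
    ; at2 = signed-power (inj₂ (trans h2 (cong -_ (sym (ℤ.*-identityʳ α)))))
    ; at3 = signed-power (inj₂ (trans h3 (cong -_ (α³ α))))
    }
    where
    α³ : ∀ x → x · x · x ≡ x · (x · (x · 1ℤ))
    α³ = ℤ-Ring.solve-∀

  block-even : ∀ k → Block k → Block (suc k) → Block (suc k + suc k)
  block-even k B B′ = record
    { at1 = pow-respˡ (h-8k+9 k)
              (pow-cast (e[8k+9] k) (pow-neg (pow-· (at3 B) (pow-cube (at1 B′)))))
    ; at2 = h₂-cancel (h-8k+10 k)
              (pow-cast (e[8k+10] k) (pow-neg (pow-· (at1 B′) (pow-· (at3 B) (pow-square (at2 B′))))))
    ; at3 = pow-respˡ (h-8k+11 k)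
              (pow-cast (e[8k+11] k) (pow-· (at3 B′) (pow-cube (at1 B′))))
    }

  -- h (8k + 5) only needs the block k; it is split off because for k = 0 it is
  -- itself the term h (4(k + 1) + 1) required by the rest of the block 2k + 1.
  at-8k+5 : ∀ k → Block k → SignedPower α (e₁ (suc (k + k))) (h (4 * suc (k + k) + 1))
  at-8k+5 k B =
    pow-respˡ (h-8k+5 k) (pow-cast (e[8k+5] k) (pow-neg (pow-· (at1 B) (pow-cube (at3 B)))))

  block-odd : ∀ k → Block k → SignedPower α (e₁ (suc k)) (h (4 * suc k + 1)) → Block (suc (k + k))
  block-odd k B h[4k+5] = record
    { at1 = at-8k+5 k B
    ; at2 = h₂-cancel (h-8k+6 k)
              (pow-cast (e[8k+6] k) (pow-· (at3 B) (pow-· h[4k+5] (pow-square (at2 B)))))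
    ; at3 = pow-respˡ (h-8k+7 k) (pow-cast (e[8k+7] k) (pow-· h[4k+5] (pow-cube (at3 B))))
    }

  -- The closed form holds on every block; the block 1 is the case k = 0 of
  -- `block-odd`, fed with its own first entry.
  blocks : ∀ q → Block q
  blocks = halving-induction Block block₀ (block-odd 0 block₀ (at-8k+5 0 block₀)) block-even
             (λ k B B′ → block-odd (suc k) B (at1 B′))

  cube-4q+1 : ∀ q → IsCube (h (4 * q + 1))
  cube-4q+1 q = pow-IsCube α≢0 (2 * q * q + q) (pow-cast (e₁-cube q) (at1 (blocks q)))

  cube-4q+3 : ∀ q → IsCube (h (4 * q + 3))
  cube-4q+3 q = pow-IsCube α≢0 (2 * q * q + 3 * q + 1) (pow-cast (e₃-cube q) (at3 (blocks q)))

  square-8j+1 : ∀ j → IsSquare (h (4 * (j + j) + 1))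
  square-8j+1 j =
    pow-IsSquare α≢0 (12 * j * j + 3 * j) (pow-cast (e₁-square j) (at1 (blocks (j + j))))

  square-8j+7 : ∀ j → IsSquare (h (4 * suc (j + j) + 3))
  square-8j+7 j =
    pow-IsSquare α≢0 (12 * j * j + 21 * j + 9) (pow-cast (e₃-square j) (at3 (blocks (suc (j + j)))))

  reindex : (P : ℤ → Set) → ∀ {i} → P (h i) → ∀ n → n ≡ i → P (h n)
  reindex P p n refl = p

  squares : ∀ j → IsSquare (h (1 + j * 8)) × IsSquare (h (7 + j * 8))
  squares j = reindex IsSquare (square-8j+1 j) (1 + j * 8) (solve (j ∷ []))
            , reindex IsSquare (square-8j+7 j) (7 + j * 8) (solve (j ∷ []))

  cubes : ∀ j → IsCube (h (1 + j * 8)) × IsCube (h (3 + j * 8))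
              × IsCube (h (5 + j * 8)) × IsCube (h (7 + j * 8))
  cubes j = reindex IsCube (cube-4q+1 (j + j)) (1 + j * 8) (solve (j ∷ []))
          , reindex IsCube (cube-4q+3 (j + j)) (3 + j * 8) (solve (j ∷ []))
          , reindex IsCube (cube-4q+1 (suc (j + j))) (5 + j * 8) (solve (j ∷ []))
          , reindex IsCube (cube-4q+3 (suc (j + j))) (7 + j * 8) (solve (j ∷ []))

by-residue : (P : ℕ → Set) → ∀ n {r} → n % 8 ≡ r → (∀ j → P (r + j * 8)) → P n
by-residue P n refl P[r+8j] = subst P (sym (m≡m%n+[m/n]*n n 8)) (P[r+8j] (n / 8))

theorem5p1 : (α : ℤ) → α ≢ 0ℤ → (h : ℕ → ℤ) → IsSeq α h →
    ((n : ℕ) → (n % 8 ≡ 1 ⊎ n % 8 ≡ 7) → IsSquare (h n))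
    × ((n : ℕ) → (n % 8 ≡ 1 ⊎ n % 8 ≡ 3 ⊎ n % 8 ≡ 5 ⊎ n % 8 ≡ 7) → IsCube (h n))
theorem5p1 α α≢0 h S = squares-mod-8 , cubes-mod-8
  where
  open Sequence α α≢0 h S

  squares-mod-8 : (n : ℕ) → (n % 8 ≡ 1 ⊎ n % 8 ≡ 7) → IsSquare (h n)
  squares-mod-8 n (inj₁ n≡1) = by-residue (IsSquare ∘ h) n n≡1 (proj₁ ∘ squares)
  squares-mod-8 n (inj₂ n≡7) = by-residue (IsSquare ∘ h) n n≡7 (proj₂ ∘ squares)

  cubes-mod-8 : (n : ℕ) → (n % 8 ≡ 1 ⊎ n % 8 ≡ 3 ⊎ n % 8 ≡ 5 ⊎ n % 8 ≡ 7) → IsCube (h n)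
  cubes-mod-8 n (inj₁ n≡1) =
    by-residue (IsCube ∘ h) n n≡1 (proj₁ ∘ cubes)
  cubes-mod-8 n (inj₂ (inj₁ n≡3)) =
    by-residue (IsCube ∘ h) n n≡3 (proj₁ ∘ proj₂ ∘ cubes)
  cubes-mod-8 n (inj₂ (inj₂ (inj₁ n≡5))) =
    by-residue (IsCube ∘ h) n n≡5 (proj₁ ∘ proj₂ ∘ proj₂ ∘ cubes)
  cubes-mod-8 n (inj₂ (inj₂ (inj₂ n≡7))) =
    by-residue (IsCube ∘ h) n n≡7 (proj₂ ∘ proj₂ ∘ proj₂ ∘ cubes)
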